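{- For any cycle $C_n$ of order $n\ge 3$, $\gamma_{tc}(M(C_n))=2n-3$.
   Context: All graphs are finite, simple and undirected. For a graph $H$, a set $D\subseteq V(H)$ is a total dominating set if every vertex of $H$ has a neighbor in $D$. A set $D\subseteq V(H)$ is a total outer-connected dominating set of $H$ if $D$ is a total dominating set and the induced subgraph $H[V(H)\setminus D]$ is connected; $\gamma_{tc}(H)$ denotes the minimum cardinality of a total outer-connected dominating set of $H$. The middle graph $M(G)$ of a graph $G$ has vertex set $V(G)\cup E(G)$, where two elements $x,y$ are adjacent iff either $x,y\in E(G)$ are edges of $G$ sharing an endpoint, or one of them is a vertex of $G$ and the other is an edge of $G$ incident to it. -}

module Defs where

open import Level using (Level; suc; _⊔_)
open import Data.Nat as ℕ using (ℕ; zero; _≤_; _<_; _∸_; _*_)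
open import Data.Bool using (Bool; _∨_; _∧_; T)
open import Data.Fin using (Fin; toℕ; _<_)
open import Data.Product using (Σ; ∃; ∃-syntax; _×_; _,_; proj₁; proj₂)
open import Data.Sum using (_⊎_; inj₁; inj₂)
open import Data.Empty using (⊥)
open import Data.List using (List; length)
open import Data.List.Membership.Propositional using (_∈_; _∉_)
open import Data.List.Relation.Unary.Unique.Propositional using (Unique)
open import Relation.Binary.PropositionalEquality using (_≡_; _≢_)

record Graph : Set₁ where
  field
    V   : Set
    Adj : V → V → Set
open Graph public

record SimpleGraph (n : ℕ) : Set where
  field
    adj   : Fin n → Fin n → Bool
    sym   : ∀ i j → adj i j ≡ adj j i
    irrfl : ∀ i → adj i i ≡ Data.Bool.false
open SimpleGraph public

asGraph : ∀ {n} → SimpleGraph n → Graph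
asGraph {n} G = record { V = Fin n ; Adj = λ i j → T (adj G i j) }

-- Edges of a simple graph: unordered pairs {i,j}, represented canonically
-- as (i , j) with i < j and i adjacent to j.
Edge : ∀ {n} → SimpleGraph n → Set
Edge {n} G = Σ (Fin n) λ i → Σ (Fin n) λ j → (i Data.Fin.< j) × T (adj G i j)

endpoint₁ endpoint₂ : ∀ {n} {G : SimpleGraph n} → Edge G → Fin n
endpoint₁ (i , _ , _) = i
endpoint₂ (_ , j , _) = j

Incident : ∀ {n} {G : SimpleGraph n} → Fin n → Edge G → Set
Incident {G = G} v e = (v ≡ endpoint₁ {G = G} e) ⊎ (v ≡ endpoint₂ {G = G} e)

EdgesAdj : ∀ {n} {G : SimpleGraph n} → Edge G → Edge G → Set
EdgesAdj {G = G} e f =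
  ((endpoint₁ {G = G} e , endpoint₂ {G = G} e) ≢ (endpoint₁ {G = G} f , endpoint₂ {G = G} f)) ×
  (∃[ v ] (Incident {G = G} v e × Incident {G = G} v f))

MiddleAdj : ∀ {n} (G : SimpleGraph n) → (Fin n ⊎ Edge G) → (Fin n ⊎ Edge G) → Set
MiddleAdj G (inj₁ u) (inj₁ v) = ⊥
MiddleAdj G (inj₁ u) (inj₂ e) = Incident {G = G} u e
MiddleAdj G (inj₂ e) (inj₁ v) = Incident {G = G} v e
MiddleAdj G (inj₂ e) (inj₂ f) = EdgesAdj {G = G} e f

Middle : ∀ {n} → SimpleGraph n → Graph
Middle G = record { V = Fin _ ⊎ Edge G ; Adj = MiddleAdj G }

-- The cycle C_n on vertices 0,…,n-1, with i ~ i+1 and n-1 ~ 0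
-- (a simple graph for n ≥ 3).
cycAdj : (n : ℕ) → Fin n → Fin n → Bool
cycAdj n i j =
  ((ℕ.suc (toℕ i) ℕ.≡ᵇ toℕ j) ∨ (ℕ.suc (toℕ j) ℕ.≡ᵇ toℕ i)) ∨
  (((toℕ i ℕ.≡ᵇ 0) ∧ (ℕ.suc (toℕ j) ℕ.≡ᵇ n)) ∨
   ((toℕ j ℕ.≡ᵇ 0) ∧ (ℕ.suc (toℕ i) ℕ.≡ᵇ n)))

module _ (H : Graph) where
  private
    W = V H

  IsTotalDominating : List W → Set
  IsTotalDominating D = ∀ v → ∃[ u ] (u ∈ D × Adj H v u)

  -- Reachability inside the subgraph induced by the complement of D.
  data ReachOut (D : List W) : W → W → Set where
    here : ∀ {u} → u ∉ D → ReachOut D u u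
    step : ∀ {u v w} → ReachOut D u v → Adj H v w → w ∉ D → ReachOut D u w

  OutConnected : List W → Set
  OutConnected D = ∀ u v → u ∉ D → v ∉ D → ReachOut D u v

  -- D (a duplicate-free list, i.e. a finite set) is a total outer-connected
  -- dominating set.
  IsTOCDS : List W → Set
  IsTOCDS D = Unique D × IsTotalDominating D × OutConnected D

  γtc≡ : ℕ → Set
  γtc≡ k = (∃[ D ] (IsTOCDS D × length D ≡ k)) ×
           (∀ D → IsTOCDS D → k ≤ length D)

-- In M(G) a vertex v of G is adjacent only to the edges at v, so a total
-- dominating set D of M(G) contains an edge at every vertex. If G has maximum
-- degree 2, an edge f outside D then has no neighbouring edge outside D (their
-- common vertex would have both of its edges outside D), so the component of f
-- in M(G) − D lies within f and its two ends. If instead every edge lies in D,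
-- M(G) − D consists of pairwise non-adjacent vertices, of which connectedness
-- leaves at most one. Either way D misses at most three elements, so
-- |D| ≥ |V(M(Cₙ))| − 3 = 2n − 3; the complement of an edge of Cₙ together with
-- its two ends attains the bound.
module Submission where

open import Defs hiding (sym)
open import Data.Nat using (ℕ; _≤_; _*_; _∸_)
open import Relation.Binary.PropositionalEquality using (_≡_)

open import Data.Bool using (T; _∨_; _∧_)
open import Data.Bool.Properties using (T-∨; T-∧; T-irrelevant)
open import Data.Empty using (⊥-elim)
open import Data.Fin using (Fin; zero; suc; toℕ; inject₁; fromℕ)
open import Data.Fin.Properties
  using (_≟_; suc-injective; toℕ-injective; toℕ-inject₁; toℕ-fromℕ; toℕ<n; ≤̄⇒inject₁<)
open import Data.List using (List; []; _∷_; _++_; length; map; filter; allFin)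
open import Data.List.Membership.Propositional using (_∈_; _∉_; lose)
open import Data.List.Membership.Propositional.Properties
  using (∈-++⁺ˡ; ∈-++⁺ʳ; ∈-map⁺; ∈-map⁻; ∈-allFin; ∈-filter⁺; ∈-filter⁻)
open import Data.List.Properties using (length-++; length-map; length-tabulate; length-removeAt′)
open import Data.List.Relation.Binary.Subset.Propositional using (_⊆_)
import Data.List.Relation.Unary.All as All
import Data.List.Relation.Unary.All.Properties as All
open import Data.List.Relation.Unary.AllPairs using ([]; _∷_)
open import Data.List.Relation.Unary.Any using (here; there; index; _─_; any?; satisfied)
open import Data.List.Relation.Unary.Unique.Propositional using (Unique)
import Data.List.Relation.Unary.Unique.Propositional.Properties as Unique
import Data.List.Membership.DecPropositional as DecMembership
open import Data.Nat as ℕ using (zero; suc; pred; _+_; z≤n; s≤s)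
import Data.Nat.Properties as ℕ
open import Data.Product using (_×_; _,_; proj₂; ∃-syntax)
import Data.Product as Product
open import Data.Sum using (_⊎_; inj₁; inj₂; [_,_]′)
import Data.Sum as Sum
open import Data.Sum.Properties using (≡-dec)
open import Function using (_∘_)
open import Function.Bundles using (Equivalence)
open import Relation.Binary.Definitions using (DecidableEquality)
open import Relation.Binary.PropositionalEquality
  using (refl; sym; trans; cong; cong₂; subst; _≢_; ≢-sym; module ≡-Reasoning)
open import Relation.Nullary using (¬_; yes; no)
open import Relation.Nullary.Decidable using (False; toWitnessFalse; decidable-stable)

module _ {A : Set} where

  ∈-─ : ∀ {x z : A} {ys} (x∈ys : x ∈ ys) → z ∈ ys → z ≢ x → z ∈ (ys ─ x∈ys)
  ∈-─ (here refl)  (here refl)  z≢x = ⊥-elim (z≢x refl)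
  ∈-─ (here _)     (there z∈ys) _   = z∈ys
  ∈-─ (there _)    (here refl)  _   = here refl
  ∈-─ (there x∈ys) (there z∈ys) z≢x = there (∈-─ x∈ys z∈ys z≢x)

  unique-⊆⇒length≤ : ∀ {xs ys : List A} → Unique xs → xs ⊆ ys → length xs ≤ length ys
  unique-⊆⇒length≤ [] _ = z≤n
  unique-⊆⇒length≤ {x ∷ xs} {ys} (x≢xs ∷ u) sub = begin
    suc (length xs)          ≤⟨ s≤s (unique-⊆⇒length≤ u xs⊆ys─x) ⟩
    suc (length (ys ─ x∈ys)) ≡⟨ sym (length-removeAt′ ys (index x∈ys)) ⟩
    length ys                ∎
    where
    open ℕ.≤-Reasoning
    x∈ys : x ∈ ys
    x∈ys = sub (here refl)
    xs⊆ys─x : xs ⊆ (ys ─ x∈ys)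
    xs⊆ys─x z∈xs = ∈-─ x∈ys (sub (there z∈xs)) (≢-sym (All.lookup x≢xs z∈xs))

  pigeonhole₂ : ∀ {x y a₁ a₂ a₃ : A} → a₁ ≡ x ⊎ a₁ ≡ y → a₂ ≡ x ⊎ a₂ ≡ y → a₃ ≡ x ⊎ a₃ ≡ y →
                a₁ ≡ a₂ ⊎ a₁ ≡ a₃ ⊎ a₂ ≡ a₃
  pigeonhole₂ (inj₁ refl) (inj₁ refl) _           = inj₁ refl
  pigeonhole₂ (inj₂ refl) (inj₂ refl) _           = inj₁ refl
  pigeonhole₂ (inj₁ refl) (inj₂ refl) (inj₁ refl) = inj₂ (inj₁ refl)
  pigeonhole₂ (inj₁ refl) (inj₂ refl) (inj₂ refl) = inj₂ (inj₂ refl)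
  pigeonhole₂ (inj₂ refl) (inj₁ refl) (inj₁ refl) = inj₂ (inj₂ refl)
  pigeonhole₂ (inj₂ refl) (inj₁ refl) (inj₂ refl) = inj₂ (inj₁ refl)

module _ {H : Graph} {D : List (V H)} where

  reachOut-end : ∀ {u v} → ReachOut H D u v → v ∉ D
  reachOut-end (here u∉D)     = u∉D
  reachOut-end (step _ _ w∉D) = w∉D

  reachOut-trans : ∀ {u v w} → ReachOut H D u v → ReachOut H D v w → ReachOut H D u w
  reachOut-trans r (here _)        = r
  reachOut-trans r (step r′ a w∉D) = step (reachOut-trans r r′) a w∉D

module MiddleGraph {n : ℕ} (G : SimpleGraph n) where

  M : Graph
  M = Middle G

  Inc : Fin n → Edge G → Set
  Inc = Incident {G = G}

  end₁ end₂ : Edge G → Fin n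
  end₁ = endpoint₁ {G = G}
  end₂ = endpoint₂ {G = G}

  edge-≡ : ∀ {e f : Edge G} → end₁ e ≡ end₁ f → end₂ e ≡ end₂ f → e ≡ f
  edge-≡ {i , j , i<j , ij} {_ , _ , i<j′ , ij′} refl refl =
    cong₂ (λ p q → i , j , p , q) (ℕ.<-irrelevant i<j i<j′) (T-irrelevant ij ij′)

  _≟ₑ_ : DecidableEquality (Edge G)
  e ≟ₑ f with end₁ e ≟ end₁ f | end₂ e ≟ end₂ f
  ... | yes p  | yes q  = yes (edge-≡ p q)
  ... | no ¬p  | _      = no (¬p ∘ cong end₁)
  ... | yes _  | no ¬q  = no (¬q ∘ cong end₂)

  _≟ᴹ_ : DecidableEquality (V M)
  _≟ᴹ_ = ≡-dec _≟_ _≟ₑ_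

  otherEnd : ∀ {v} e → Inc v e → Fin n
  otherEnd e (inj₁ _) = end₂ e
  otherEnd e (inj₂ _) = end₁ e

  otherEnd-adjacent : ∀ {v} e (v∈e : Inc v e) → T (adj G v (otherEnd e v∈e))
  otherEnd-adjacent (_ , _ , _ , ij) (inj₁ refl) = ij
  otherEnd-adjacent (i , j , _ , ij) (inj₂ refl) = subst T (SimpleGraph.sym G i j) ij

  otherEnd-injective : ∀ {v} e f (v∈e : Inc v e) (v∈f : Inc v f) →
                       otherEnd e v∈e ≡ otherEnd f v∈f → e ≡ f
  otherEnd-injective e f (inj₁ refl) (inj₁ v≡) ends≡ = edge-≡ v≡ ends≡
  otherEnd-injective e f (inj₂ refl) (inj₂ v≡) ends≡ = edge-≡ ends≡ v≡
  otherEnd-injective (_ , _ , i<j , _) (_ , _ , i′<j′ , _) (inj₁ refl) (inj₂ refl) refl =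
    ⊥-elim (ℕ.<-asym i<j i′<j′)
  otherEnd-injective (_ , _ , i<j , _) (_ , _ , i′<j′ , _) (inj₂ refl) (inj₁ refl) refl =
    ⊥-elim (ℕ.<-asym i<j i′<j′)

  MaxDegree≤2 : Set
  MaxDegree≤2 = ∀ {v w₁ w₂ w₃} → T (adj G v w₁) → T (adj G v w₂) → T (adj G v w₃) →
                w₁ ≡ w₂ ⊎ w₁ ≡ w₃ ⊎ w₂ ≡ w₃

  incident-pigeonhole : MaxDegree≤2 → ∀ {v e f g} → Inc v e → Inc v f → Inc v g →
                        e ≡ f ⊎ e ≡ g ⊎ f ≡ g
  incident-pigeonhole Δ {e = e} {f} {g} v∈e v∈f v∈g =
    Sum.map (otherEnd-injective e f v∈e v∈f)
            (Sum.map (otherEnd-injective e g v∈e v∈g) (otherEnd-injective f g v∈f v∈g))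
            (Δ (otherEnd-adjacent e v∈e) (otherEnd-adjacent f v∈f) (otherEnd-adjacent g v∈g))

  withEnds : Edge G → List (V M)
  withEnds f = inj₂ f ∷ inj₁ (end₁ f) ∷ inj₁ (end₂ f) ∷ []

  withEnds-unique : ∀ f → Unique (withEnds f)
  withEnds-unique (i , j , i<j , _) =
    ((λ ()) All.∷ (λ ()) All.∷ All.[]) ∷ (ends≢ All.∷ All.[]) ∷ All.[] ∷ []
    where
    ends≢ : _≢_ {A = V M} (inj₁ i) (inj₁ j)
    ends≢ refl = ℕ.<-irrefl refl i<j

  module _ {D : List (V M)} {f : Edge G} (withEnds∩D≡∅ : ∀ {y} → y ∈ withEnds f → y ∉ D) where

    private
      reach-centre : ∀ {y} → y ∈ withEnds f → ReachOut M D y (inj₂ f)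
      reach-centre (here refl)                 = here (withEnds∩D≡∅ (here refl))
      reach-centre (there (here refl))         =
        step (here (withEnds∩D≡∅ (there (here refl)))) (inj₁ refl) (withEnds∩D≡∅ (here refl))
      reach-centre (there (there (here refl))) =
        step (here (withEnds∩D≡∅ (there (there (here refl))))) (inj₂ refl) (withEnds∩D≡∅ (here refl))

      leave-centre : ∀ {z} → z ∈ withEnds f → ReachOut M D (inj₂ f) z
      leave-centre (here refl)                 = here (withEnds∩D≡∅ (here refl))
      leave-centre (there (here refl))         =
        step (here (withEnds∩D≡∅ (here refl))) (inj₁ refl) (withEnds∩D≡∅ (there (here refl)))
      leave-centre (there (there (here refl))) =
        step (here (withEnds∩D≡∅ (here refl))) (inj₂ refl) (withEnds∩D≡∅ (there (there (here refl))))

    withEnds-connected : ∀ {y z} → y ∈ withEnds f → z ∈ withEnds f → ReachOut M D y z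
    withEnds-connected y∈ z∈ = reachOut-trans (reach-centre y∈) (leave-centre z∈)

  reachOut-≡ : ∀ {D} → (∀ f → inj₂ f ∈ D) → ∀ {x y} → ReachOut M D x y → x ≡ y
  reachOut-≡ edges⊆D (here _)                              = refl
  reachOut-≡ edges⊆D (step {w = inj₂ g} _ _ w∉D)           = ⊥-elim (w∉D (edges⊆D g))
  reachOut-≡ edges⊆D (step {v = inj₂ g} {w = inj₁ _} r _ _) = ⊥-elim (reachOut-end r (edges⊆D g))
  reachOut-≡ edges⊆D (step {v = inj₁ _} {w = inj₁ _} _ () _)

  module _ (Δ : MaxDegree≤2) {D : List (V M)} (td : IsTotalDominating M D) where

    dominatingEdge : ∀ v → ∃[ g ] (inj₂ g ∈ D × Inc v g)
    dominatingEdge v with td (inj₁ v)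
    ... | inj₂ g , g∈D , v∈g = g , g∈D , v∈g

    incident-outside-unique : ∀ {x f g} → Inc x f → Inc x g → inj₂ f ∉ D → inj₂ g ∉ D → f ≡ g
    incident-outside-unique {x} {f} {g} x∈f x∈g f∉D g∉D with dominatingEdge x
    ... | h , h∈D , x∈h with incident-pigeonhole Δ {e = f} {g} {h} x∈f x∈g x∈h
    ...   | inj₁ f≡g         = f≡g
    ...   | inj₂ (inj₁ refl) = ⊥-elim (f∉D h∈D)
    ...   | inj₂ (inj₂ refl) = ⊥-elim (g∉D h∈D)

    withEnds-closed : ∀ {f y w} → inj₂ f ∉ D → y ∈ withEnds f → Adj M y w → w ∉ D →
                      w ∈ withEnds f
    withEnds-closed {w = inj₁ _} _ (here refl) (inj₁ refl) _ = there (here refl)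
    withEnds-closed {w = inj₁ _} _ (here refl) (inj₂ refl) _ = there (there (here refl))
    withEnds-closed {f} {w = inj₂ g} f∉D (here refl) (f≢g , _ , x∈f , x∈g) g∉D =
      ⊥-elim (f≢g (cong (λ e → end₁ e , end₂ e) (incident-outside-unique x∈f x∈g f∉D g∉D)))
    withEnds-closed {w = inj₁ _} _ (there (here refl)) () _
    withEnds-closed {w = inj₁ _} _ (there (there (here refl))) () _
    withEnds-closed {w = inj₂ g} f∉D (there (here refl)) x∈g g∉D =
      here (cong inj₂ (sym (incident-outside-unique (inj₁ refl) x∈g f∉D g∉D)))
    withEnds-closed {w = inj₂ g} f∉D (there (there (here refl))) x∈g g∉D =
      here (cong inj₂ (sym (incident-outside-unique (inj₂ refl) x∈g f∉D g∉D)))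

    reachOut-withEnds : ∀ {f y} → inj₂ f ∉ D → ReachOut M D (inj₂ f) y → y ∈ withEnds f
    reachOut-withEnds f∉D (here _)       = here refl
    reachOut-withEnds f∉D (step r a w∉D) = withEnds-closed f∉D (reachOut-withEnds f∉D r) a w∉D

  module Enumeration (es : List (Edge G)) (es-complete : ∀ f → f ∈ es) where

    open DecMembership _≟ᴹ_ using (_∈?_; _∉?_)

    elements : List (V M)
    elements = map inj₁ (allFin n) ++ map inj₂ es

    ∈-elements : ∀ y → y ∈ elements
    ∈-elements (inj₁ v) = ∈-++⁺ˡ (∈-map⁺ inj₁ (∈-allFin v))
    ∈-elements (inj₂ f) = ∈-++⁺ʳ (map inj₁ (allFin n)) (∈-map⁺ inj₂ (es-complete f))

    elements-unique : Unique es → Unique elements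
    elements-unique es-unique =
      Unique.++⁺ (Unique.map⁺ (λ { refl → refl }) (Unique.allFin⁺ n))
                 (Unique.map⁺ (λ { refl → refl }) es-unique)
                 vertex≢edge
      where
      vertex≢edge : ∀ {y} → ¬ (y ∈ map inj₁ (allFin n) × y ∈ map inj₂ es)
      vertex≢edge (y∈vs , y∈es) with ∈-map⁻ inj₁ y∈vs | ∈-map⁻ inj₂ y∈es
      ... | _ , _ , refl | _ , _ , ()

    length-elements : length elements ≡ n + length es
    length-elements = begin
      length elements
        ≡⟨ length-++ (map inj₁ (allFin n)) ⟩
      length (map inj₁ (allFin n)) + length (map inj₂ es)
        ≡⟨ cong₂ _+_ (length-map inj₁ (allFin n)) (length-map inj₂ es) ⟩
      length (allFin n) + length es
        ≡⟨ cong (_+ length es) (length-tabulate (λ i → i)) ⟩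
      n + length es
        ∎
      where open ≡-Reasoning

    complement-small : MaxDegree≤2 → ∀ {D} → IsTotalDominating M D → OutConnected M D →
                       ∃[ S ] (length S ≤ 3 × (∀ y → y ∉ D → y ∈ S))
    complement-small Δ {D} td oc with any? (λ f → inj₂ f ∉? D) es
    ... | yes some-edge-outside =
      let f , f∉D = satisfied some-edge-outside in
      withEnds f , ℕ.≤-refl , λ y y∉D → reachOut-withEnds Δ td f∉D (oc _ _ f∉D y∉D)
    ... | no no-edge-outside with any? (_∉? D) elements
    ...   | yes something-outside =
      let x , x∉D = satisfied something-outside in
      x ∷ [] , s≤s z≤n , λ y y∉D → here (sym (reachOut-≡ edges⊆D (oc x y x∉D y∉D)))
      where
      edges⊆D : ∀ f → inj₂ f ∈ D
      edges⊆D f = decidable-stable (inj₂ f ∈? D) (no-edge-outside ∘ lose (es-complete f))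
    ...   | no nothing-outside = [] , z≤n , λ y y∉D → ⊥-elim (nothing-outside (lose (∈-elements y) y∉D))

    elements-⊆-++ : ∀ {D} S → (∀ y → y ∉ D → y ∈ S) → elements ⊆ S ++ D
    elements-⊆-++ {D} S D∁⊆S {y} _ with y ∈? D
    ... | yes y∈D = ∈-++⁺ʳ S y∈D
    ... | no y∉D  = ∈-++⁺ˡ (D∁⊆S y y∉D)

    tocds-length≥ : MaxDegree≤2 → Unique es → ∀ {D} → IsTOCDS M D → length elements ≤ 3 + length D
    tocds-length≥ Δ es-unique {D} (_ , td , oc) with complement-small Δ td oc
    ... | S , |S|≤3 , D∁⊆S = begin
      length elements     ≤⟨ unique-⊆⇒length≤ (elements-unique es-unique) (elements-⊆-++ S D∁⊆S) ⟩
      length (S ++ D)     ≡⟨ length-++ S ⟩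
      length S + length D ≤⟨ ℕ.+-monoˡ-≤ (length D) |S|≤3 ⟩
      3 + length D        ∎
      where open ℕ.≤-Reasoning

private
  T-∨⁻ : ∀ {x y} → T (x ∨ y) → T x ⊎ T y
  T-∨⁻ = Equivalence.to T-∨

  T-∨⁺ˡ : ∀ {x y} → T x → T (x ∨ y)
  T-∨⁺ˡ = Equivalence.from T-∨ ∘ inj₁

  T-∨⁺ʳ : ∀ x {y} → T y → T (x ∨ y)
  T-∨⁺ʳ x = Equivalence.from (T-∨ {x}) ∘ inj₂

  ≡ᵇ∧≡ᵇ⇒≡×≡ : ∀ {a b c d} → T ((a ℕ.≡ᵇ b) ∧ (c ℕ.≡ᵇ d)) → a ≡ b × c ≡ d
  ≡ᵇ∧≡ᵇ⇒≡×≡ = Product.map (ℕ.≡ᵇ⇒≡ _ _) (ℕ.≡ᵇ⇒≡ _ _) ∘ Equivalence.to T-∧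

CycStep : ℕ → ℕ → ℕ → Set
CycStep n a b = suc a ≡ b ⊎ (b ≡ 0 × suc a ≡ n)

cycAdj⇒cycStep : ∀ {n} (i j : Fin n) → T (cycAdj n i j) →
                 CycStep n (toℕ i) (toℕ j) ⊎ CycStep n (toℕ j) (toℕ i)
cycAdj⇒cycStep {n} i j = decode (toℕ i) (toℕ j)
  where
  decode : ∀ a b → T (((suc a ℕ.≡ᵇ b) ∨ (suc b ℕ.≡ᵇ a)) ∨
                      (((a ℕ.≡ᵇ 0) ∧ (suc b ℕ.≡ᵇ n)) ∨ ((b ℕ.≡ᵇ 0) ∧ (suc a ℕ.≡ᵇ n)))) →
           CycStep n a b ⊎ CycStep n b a
  decode a b =
    [ [ inj₁ ∘ inj₁ ∘ ℕ.≡ᵇ⇒≡ _ _ , inj₂ ∘ inj₁ ∘ ℕ.≡ᵇ⇒≡ _ _ ]′ ∘ T-∨⁻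
    , [ inj₂ ∘ inj₂ ∘ ≡ᵇ∧≡ᵇ⇒≡×≡ , inj₁ ∘ inj₂ ∘ ≡ᵇ∧≡ᵇ⇒≡×≡ ]′ ∘ T-∨⁻
    ]′ ∘ T-∨⁻

cycAdj-suc : ∀ {n} (i j : Fin n) → suc (toℕ i) ≡ toℕ j → T (cycAdj n i j)
cycAdj-suc i j i+1≡j = T-∨⁺ˡ (T-∨⁺ˡ (ℕ.≡⇒≡ᵇ _ _ i+1≡j))

cycAdj-wrap : ∀ {n} (i j : Fin n) → toℕ i ≡ 0 → suc (toℕ j) ≡ n → T (cycAdj n i j)
cycAdj-wrap i j i≡0 j+1≡n =
  T-∨⁺ʳ ((suc (toℕ i) ℕ.≡ᵇ toℕ j) ∨ (suc (toℕ j) ℕ.≡ᵇ toℕ i))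
        (T-∨⁺ˡ (Equivalence.from T-∧ (ℕ.≡⇒≡ᵇ _ _ i≡0 , ℕ.≡⇒≡ᵇ _ _ j+1≡n)))

next : ℕ → ℕ → ℕ
next n a with suc a ℕ.≟ n
... | yes _ = 0
... | no _  = suc a

prev : ℕ → ℕ → ℕ
prev n zero    = pred n
prev n (suc a) = a

cycStep⇒≡next : ∀ {n a b} → b ℕ.< n → CycStep n a b → b ≡ next n a
cycStep⇒≡next {n} {a} b<n a→b with suc a ℕ.≟ n | a→b
... | yes refl   | inj₁ refl        = ⊥-elim (ℕ.<-irrefl refl b<n)
... | yes _      | inj₂ (b≡0 , _)   = b≡0
... | no _       | inj₁ a+1≡b       = sym a+1≡b
... | no a+1≢n   | inj₂ (_ , a+1≡n) = ⊥-elim (a+1≢n a+1≡n)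

cycStep⇒≡prev : ∀ {n a b} → CycStep n b a → b ≡ prev n a
cycStep⇒≡prev (inj₁ refl)          = refl
cycStep⇒≡prev (inj₂ (refl , refl)) = refl

cycAdj-neighbours : ∀ {n} {v w : Fin n} → T (cycAdj n v w) →
                    toℕ w ≡ next n (toℕ v) ⊎ toℕ w ≡ prev n (toℕ v)
cycAdj-neighbours {v = v} {w} vw =
  [ inj₁ ∘ cycStep⇒≡next (toℕ<n w) , inj₂ ∘ cycStep⇒≡prev ]′ (cycAdj⇒cycStep v w vw)

module Cycle (m : ℕ) (C : SimpleGraph (3 + m)) (C-cycle : adj C ≡ cycAdj (3 + m)) where

  open MiddleGraph C
  open DecMembership _≟ᴹ_ using (_∈?_; _∉?_)

  private
    k n : ℕ
    k = 2 + m
    n = 3 + m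

  adj⇒cycAdj : ∀ {i j} → T (adj C i j) → T (cycAdj n i j)
  adj⇒cycAdj {i} {j} = subst (λ a → T (a i j)) C-cycle

  cycAdj⇒adj : ∀ {i j} → T (cycAdj n i j) → T (adj C i j)
  cycAdj⇒adj {i} {j} = subst (λ a → T (a i j)) (sym C-cycle)

  cycle-maxDegree≤2 : MaxDegree≤2
  cycle-maxDegree≤2 vw₁ vw₂ vw₃ =
    Sum.map toℕ-injective (Sum.map toℕ-injective toℕ-injective)
      (pigeonhole₂ (cycAdj-neighbours (adj⇒cycAdj vw₁))
                   (cycAdj-neighbours (adj⇒cycAdj vw₂))
                   (cycAdj-neighbours (adj⇒cycAdj vw₃)))

  pathEdge : Fin k → Edge C
  pathEdge i = inject₁ i , suc i , ≤̄⇒inject₁< ℕ.≤-refl ,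
               cycAdj⇒adj (cycAdj-suc (inject₁ i) (suc i) (cong suc (toℕ-inject₁ i)))

  closingEdge : Edge C
  closingEdge = zero , fromℕ k , s≤s z≤n ,
                cycAdj⇒adj (cycAdj-wrap zero (fromℕ k) refl (cong suc (toℕ-fromℕ k)))

  edges : List (Edge C)
  edges = closingEdge ∷ map pathEdge (allFin k)

  edges-complete : ∀ f → f ∈ edges
  edges-complete (_ , zero , () , _)
  edges-complete (i , suc j , i<j+1 , ij) with cycAdj⇒cycStep i (suc j) (adj⇒cycAdj ij)
  ... | inj₁ (inj₁ i+1≡j+1) =
    there (subst (_∈ map pathEdge (allFin k)) (sym f≡pathEdge) (∈-map⁺ pathEdge (∈-allFin j)))
    where
    f≡pathEdge : (i , suc j , i<j+1 , ij) ≡ pathEdge j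
    f≡pathEdge = edge-≡ (toℕ-injective (trans (ℕ.suc-injective i+1≡j+1) (sym (toℕ-inject₁ j)))) refl
  ... | inj₁ (inj₂ (() , _))
  ... | inj₂ (inj₁ j+2≡i) = ⊥-elim (ℕ.<-asym i<j+1 (ℕ.≤-reflexive j+2≡i))
  ... | inj₂ (inj₂ (i≡0 , j+2≡n)) =
    here (edge-≡ (toℕ-injective i≡0)
                 (toℕ-injective (trans (ℕ.suc-injective j+2≡n) (sym (toℕ-fromℕ k)))))

  pathEdge-injective : ∀ {i j} → pathEdge i ≡ pathEdge j → i ≡ j
  pathEdge-injective = suc-injective ∘ cong end₂

  closingEdge≢pathEdge : ∀ i → closingEdge ≢ pathEdge i
  closingEdge≢pathEdge zero    ()
  closingEdge≢pathEdge (suc _) ()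

  edges-unique : Unique edges
  edges-unique = All.map⁺ (All.tabulate⁺ closingEdge≢pathEdge)
               ∷ Unique.map⁺ pathEdge-injective (Unique.allFin⁺ k)

  length-edges : length edges ≡ n
  length-edges = cong suc (trans (length-map pathEdge (allFin k)) (length-tabulate (λ i → i)))

  open Enumeration edges edges-complete

  length-elements≡2n : length elements ≡ 2 * n
  length-elements≡2n = trans length-elements (cong (n +_) (trans length-edges (sym (ℕ.+-identityʳ n))))

  cycle-tocds-length≥ : ∀ {D} → IsTOCDS M D → 2 * n ≤ 3 + length D
  cycle-tocds-length≥ {D} tocds =
    subst (_≤ 3 + length D) length-elements≡2n (tocds-length≥ cycle-maxDegree≤2 edges-unique tocds)

  e₀ : Edge C
  e₀ = pathEdge zero

  D₀ : List (V M)
  D₀ = filter (_∉? withEnds e₀) elements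

  withEnds-∉D₀ : ∀ {y} → y ∈ withEnds e₀ → y ∉ D₀
  withEnds-∉D₀ y∈ y∈D₀ = proj₂ (∈-filter⁻ (_∉? withEnds e₀) {xs = elements} y∈D₀) y∈

  ∉D₀⇒∈withEnds : ∀ {y} → y ∉ D₀ → y ∈ withEnds e₀
  ∉D₀⇒∈withEnds {y} y∉D₀ =
    decidable-stable (y ∈? withEnds e₀) (y∉D₀ ∘ ∈-filter⁺ (_∉? withEnds e₀) (∈-elements y))

  -- For a concrete y the decision evaluates, so the second argument is just _.
  ∈D₀ : ∀ y → False (y ∈? withEnds e₀) → y ∈ D₀
  ∈D₀ y y∉ = ∈-filter⁺ (_∉? withEnds e₀) (∈-elements y) (toWitnessFalse y∉)

  D₀-dominating : IsTotalDominating M D₀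
  D₀-dominating (inj₁ zero)                  = inj₂ closingEdge , ∈D₀ _ _ , inj₁ refl
  D₀-dominating (inj₁ (suc zero))            = inj₂ (pathEdge (suc zero)) , ∈D₀ _ _ , inj₁ refl
  D₀-dominating (inj₁ (suc (suc i)))         = inj₂ (pathEdge (suc i)) , ∈D₀ _ _ , inj₂ refl
  D₀-dominating (inj₂ (_ , zero , () , _))
  D₀-dominating (inj₂ (_ , suc zero , _))    =
    inj₂ (pathEdge (suc zero)) , ∈D₀ _ _ , (λ ()) , suc zero , inj₂ refl , inj₁ refl
  D₀-dominating (inj₂ (_ , suc (suc j) , _)) = inj₁ (suc (suc j)) , ∈D₀ _ _ , inj₂ refl

  D₀-unique : Unique D₀
  D₀-unique = Unique.filter⁺ (_∉? withEnds e₀) {xs = elements} (elements-unique edges-unique)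

  D₀-outConnected : OutConnected M D₀
  D₀-outConnected _ _ y∉D₀ z∉D₀ =
    withEnds-connected withEnds-∉D₀ (∉D₀⇒∈withEnds y∉D₀) (∉D₀⇒∈withEnds z∉D₀)

  D₀-tocds : IsTOCDS M D₀
  D₀-tocds = D₀-unique , D₀-dominating , D₀-outConnected

  length-D₀ : length D₀ ≡ 2 * n ∸ 3
  length-D₀ = begin
    length D₀         ≡⟨ sym (ℕ.m+n∸m≡n 3 (length D₀)) ⟩
    3 + length D₀ ∸ 3 ≡⟨ cong (_∸ 3) (ℕ.≤-antisym withEnds++D₀-length≤ (cycle-tocds-length≥ D₀-tocds)) ⟩
    2 * n ∸ 3         ∎
    where
    open ≡-Reasoning
    withEnds++D₀-unique : Unique (withEnds e₀ ++ D₀)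
    withEnds++D₀-unique =
      Unique.++⁺ (withEnds-unique e₀) D₀-unique (λ (y∈ , y∈D₀) → withEnds-∉D₀ y∈ y∈D₀)
    withEnds++D₀-length≤ : 3 + length D₀ ≤ 2 * n
    withEnds++D₀-length≤ = subst (3 + length D₀ ≤_) length-elements≡2n
      (unique-⊆⇒length≤ withEnds++D₀-unique (λ {y} _ → ∈-elements y))

theorem2p3 : (n : ℕ) → 3 ≤ n →
    (C : SimpleGraph n) → adj C ≡ cycAdj n →
    γtc≡ (Middle C) (2 * n ∸ 3)
theorem2p3 n@(suc (suc (suc m))) (s≤s (s≤s (s≤s _))) C C-cycle =
  (D₀ , D₀-tocds , length-D₀) ,
  λ _ tocds → ℕ.m≤n+o⇒m∸n≤o (2 * n) 3 (cycle-tocds-length≥ tocds)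
  where open Cycle m C C-cycle
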